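{- Let $\Omega=\{u\in\mathbb{Q}^{\omega_1}: 0\leq u_\alpha\leq 1\text{ for all }\alpha<\omega_1,\text{ and }u_\gamma\leq 2u_\beta\text{ whenever }0<\gamma<\beta<\omega_1\}$, and let $G$ be the $\mathbb{Q}$-vector sublattice of $\mathbb{Q}^{\Omega}$ generated by the projections $p_\alpha\colon u\mapsto u_\alpha$ ($\alpha<\omega_1$) and the constant function $u\mapsto 1$. Then for every $\alpha\in\omega_1\setminus\{0\}$ and every positive rational $c$, the principal $\ell$-ideals $\langle(p_0-cp_\alpha)^+\rangle$ and $\langle(cp_\alpha-p_0)^+\rangle$ are pseudocomplements of each other in $\operatorname{Id}_c G$.
   Context: For $a\in G$, $a^+=a\vee 0$ and $\langle a\rangle=\{x\in G:-n|a|\leq x\leq n|a|\text{ for some }n\in\omega\}$ with $|a|=a\vee(-a)$; $\operatorname{Id}_c G$ is the lattice of all such $\langle a\rangle$ under inclusion, with least element $\{0\}$. In a lattice with $0$, $\boldsymbol{y}$ is the pseudocomplement of $\boldsymbol{x}$ if $\boldsymbol{y}$ is the largest element $\boldsymbol{t}$ with $\boldsymbol{t}\wedge\boldsymbol{x}=0$. -}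

module Defs where

open import Level using (0ℓ)
open import Data.Nat using (ℕ)
open import Data.Integer using (+_)
open import Data.Rational using (ℚ; 0ℚ; 1ℚ; _+_; _*_; -_; _-_; _≤_; _⊔_; _/_)
open import Data.Product using (Σ; ∃; _×_; _,_; proj₁)
open import Relation.Binary using (Rel; IsStrictTotalOrder)
open import Relation.Binary.PropositionalEquality using (_≡_)
open import Relation.Nullary using (¬_)
open import Induction.WellFounded using (WellFounded)

-- A model of ω₁: an uncountable well-order all of whose proper initial
-- segments are countable (unique up to isomorphism: order type ω₁).
record Omega1 : Set₁ where
  field
    I           : Set
    _<_         : Rel I 0ℓ
    isSTO       : IsStrictTotalOrder _≡_ _<_
    wf          : WellFounded _<_
    𝟘           : I
    𝟘-least     : ∀ α → ¬ (α < 𝟘)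
    uncountable : ∀ (f : ℕ → I) → ¬ (∀ α → ∃ λ n → f n ≡ α)
    segCountable : ∀ α → ∃ λ (g : Σ I (λ β → β < α) → ℕ) →
                     ∀ x y → g x ≡ g y → proj₁ x ≡ proj₁ y

module Ops (W : Omega1) where
  open Omega1 W

  two : ℚ
  two = + 2 / 1

  record Ω : Set where
    field
      u     : I → ℚ
      u-nn  : ∀ α → 0ℚ ≤ u α
      u-le1 : ∀ α → u α ≤ 1ℚ
      u-cond : ∀ γ β → 𝟘 < γ → γ < β → u γ ≤ two * u β
  open Ω

  Fun : Set
  Fun = Ω → ℚ

  proj : I → Fun
  proj α w = u w α

  𝟙 : Fun
  𝟙 _ = 1ℚ

  𝟎 : Fun
  𝟎 _ = 0ℚ

  _⊕_ : Fun → Fun → Fun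
  (f ⊕ g) w = f w + g w

  _·_ : ℚ → Fun → Fun
  (c · f) w = c * f w

  _⊖_ : Fun → Fun → Fun
  (f ⊖ g) w = f w - g w

  _∨_ : Fun → Fun → Fun
  (f ∨ g) w = f w ⊔ g w

  ⊝_ : Fun → Fun
  (⊝ f) w = - f w

  _⁺ : Fun → Fun
  f ⁺ = f ∨ 𝟎

  ∣_∣f : Fun → Fun
  ∣ f ∣f = f ∨ (⊝ f)

  -- Terms of the ℚ-vector-lattice language over the generators
  -- (projections and the constant 1); meets are definable from joins and
  -- negation (a ∧ b = -((-a) ∨ (-b))), 0 = 0·1, -a = (-1)·a.
  data Term : Set where
    `p   : I → Term
    `1   : Term
    _`+_ : Term → Term → Term
    _`·_ : ℚ → Term → Term
    _`∨_ : Term → Term → Term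

  ⟦_⟧ : Term → Fun
  ⟦ `p α ⟧ = proj α
  ⟦ `1 ⟧ = 𝟙
  ⟦ s `+ t ⟧ = ⟦ s ⟧ ⊕ ⟦ t ⟧
  ⟦ c `· t ⟧ = c · ⟦ t ⟧
  ⟦ s `∨ t ⟧ = ⟦ s ⟧ ∨ ⟦ t ⟧

  InG : Fun → Set
  InG f = ∃ λ (t : Term) → ∀ w → ⟦ t ⟧ w ≡ f w

  ℕ→ℚ : ℕ → ℚ
  ℕ→ℚ n = + n / 1

  ⟨_⟩ : Fun → Fun → Set
  ⟨ a ⟩ x = InG x × ∃ λ (n : ℕ) → ∀ w →
              (- (ℕ→ℚ n * ∣ a ∣f w) ≤ x w) × (x w ≤ ℕ→ℚ n * ∣ a ∣f w)

  _⊆⟨⟩_ : Fun → Fun → Set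
  a ⊆⟨⟩ b = ∀ x → ⟨ a ⟩ x → ⟨ b ⟩ x

  -- in Id_c G, ⟨a⟩ ∧ ⟨b⟩ = {0} = ⟨0⟩: every element of Id_c G below both
  -- is below the least element
  MeetZero : Fun → Fun → Set
  MeetZero a b = ∀ z → InG z → z ⊆⟨⟩ a → z ⊆⟨⟩ b → z ⊆⟨⟩ 𝟎

  IsPseudocomplement : Fun → Fun → Set
  IsPseudocomplement y x =
    MeetZero y x × (∀ t → InG t → MeetZero t x → t ⊆⟨⟩ y)

-- At every point of Ω one of a = (p₀ - c·p_α)⁺ and b = (c·p_α - p₀)⁺
-- vanishes, so ⟨a⟩ ∧ ⟨b⟩ = 0. For maximality, if ⟨t⟩ ∧ ⟨b⟩ = 0 then t
-- vanishes wherever b does not (look at |t| ∧ |b| ∈ G). Every w ∈ Ω lies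
-- within sup-distance a(w) + ε of a point of Ω where b > 0: raise the
-- coordinates from α on to ε and lower coordinate 0, which the doubling
-- condition does not constrain, below c·w_α. Elements of G are Lipschitz for
-- the sup distance, so |t| ≤ L·a and t ∈ ⟨a⟩. Symmetrically, capping
-- coordinate α near w₀/c and the coordinates below α at twice that, while
-- raising coordinate 0 to ε/2, makes a positive within distance (2/c)·b(w) + ε.

module Submission where

open import Data.Nat as ℕ using (ℕ)
import Data.Nat.Coprimality as Coprimality
open import Data.Integer as ℤ using (+_; -[1+_])
import Data.Integer.Properties as ℤ
open import Data.Rational
open import Data.Rational.Properties
open import Data.Rational.Solver using (module +-*-Solver)
open +-*-Solver using (solve; _:=_; _:+_; _:*_; _:-_; :-_; con)
open import Data.Product using (Σ; ∃; _×_; _,_; proj₁; proj₂)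
open import Data.Sum using (_⊎_; inj₁; inj₂; [_,_]′; swap)
open import Function using (_∘_)
open import Relation.Binary.PropositionalEquality
open import Relation.Binary.Definitions using (tri<; tri≈; tri>)
open import Relation.Binary.Structures using (IsStrictTotalOrder)
open import Relation.Nullary using (yes; no; contradiction)
open import Defs

neg-involutive : ∀ p → - (- p) ≡ p
neg-involutive = solve 1 (λ p → :- (:- p) := p) refl

-1*p≡-p : ∀ p → (- 1ℚ) * p ≡ - p
-1*p≡-p = solve 1 (λ p → (:- con 1ℚ) :* p := :- p) refl

p≤p+q : ∀ {p q} → 0ℚ ≤ q → p ≤ p + q
p≤p+q {p} 0≤q = subst (_≤ p + _) (+-identityʳ p) (+-monoʳ-≤ p 0≤q)

p≤q+p : ∀ {p q} → 0ℚ ≤ q → p ≤ q + p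
p≤q+p {p} {q} 0≤q = subst (p ≤_) (+-comm p q) (p≤p+q 0≤q)

p-q≤p : ∀ {p q} → 0ℚ ≤ q → p - q ≤ p
p-q≤p {p} {q} 0≤q = subst (p - q ≤_) (solve 2 (λ p q → (p :- q) :+ q := p) refl p q) (p≤p+q 0≤q)

p≤q⇒p-r<q : ∀ {p q r} → 0ℚ < r → p ≤ q → p - r < q
p≤q⇒p-r<q {p} {q} {r} 0<r p≤q = ≤-<-trans (+-monoˡ-≤ (- r) p≤q)
  (subst (q - r <_) (+-identityʳ q) (+-monoʳ-< q (neg-antimono-< 0<r)))

p≤q+r⇒p-q≤r : ∀ {p q r} → p ≤ q + r → p - q ≤ r
p≤q+r⇒p-q≤r {p} {q} {r} h =
  subst (p - q ≤_) (solve 2 (λ q r → (q :+ r) :- q := r) refl q r) (+-monoˡ-≤ (- q) h)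

p≤q⇒0≤q-p : ∀ {p q} → p ≤ q → 0ℚ ≤ q - p
p≤q⇒0≤q-p {p} {q} h = subst (_≤ q - p) (+-inverseʳ p) (+-monoˡ-≤ (- p) h)

p≤q⇒p-q≤0 : ∀ {p q} → p ≤ q → p - q ≤ 0ℚ
p≤q⇒p-q≤0 {p} {q} h = subst (p - q ≤_) (+-inverseʳ q) (+-monoˡ-≤ (- q) h)

p<q⇒0<[q-p]⁺ : ∀ {p q} → p < q → 0ℚ < (q - p) ⊔ 0ℚ
p<q⇒0<[q-p]⁺ {p} {q} h = <-≤-trans (subst (_< q - p) (+-inverseʳ p) (+-monoˡ-< (- p) h)) (p≤p⊔q _ _)

⊔-<-lub : ∀ {p q r} → p < r → q < r → p ⊔ q < r
⊔-<-lub {p} {q} p<r q<r with ⊔-sel p q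
... | inj₁ p⊔q≡p = subst (_< _) (sym p⊔q≡p) p<r
... | inj₂ p⊔q≡q = subst (_< _) (sym p⊔q≡q) q<r

⊓-<-glb : ∀ {p q r} → r < p → r < q → r < p ⊓ q
⊓-<-glb {p} {q} r<p r<q with ⊓-sel p q
... | inj₁ p⊓q≡p = subst (_ <_) (sym p⊓q≡p) r<p
... | inj₂ p⊓q≡q = subst (_ <_) (sym p⊓q≡q) r<q

p≤p⊓q+[p-q]⁺ : ∀ p q → p ≤ p ⊓ q + ((p - q) ⊔ 0ℚ)
p≤p⊓q+[p-q]⁺ p q with ⊓-sel p q
... | inj₁ p⊓q≡p = subst (λ z → p ≤ z + ((p - q) ⊔ 0ℚ)) (sym p⊓q≡p) (p≤p+q (p≤q⊔p (p - q) 0ℚ))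
... | inj₂ p⊓q≡q = subst (λ z → p ≤ z + ((p - q) ⊔ 0ℚ)) (sym p⊓q≡q) (begin
  p                    ≡⟨ solve 2 (λ p q → p := q :+ (p :- q)) refl p q ⟩
  q + (p - q)          ≤⟨ +-monoʳ-≤ q (p≤p⊔q _ _) ⟩
  q + ((p - q) ⊔ 0ℚ)   ∎)
  where open ≤-Reasoning

≤-sum : ∀ {x p q r s δ} → x ≤ p + q → p ≤ r * δ → q ≤ s * δ → x ≤ (r + s) * δ
≤-sum {p = p} {q} {r} {s} {δ} x≤p+q p≤rδ q≤sδ =
  ≤-trans x≤p+q (subst (p + q ≤_) (sym (*-distribʳ-+ δ r s)) (+-mono-≤ p≤rδ q≤sδ))

∣p∣≡p⊔-p : ∀ p → ∣ p ∣ ≡ p ⊔ - p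
∣p∣≡p⊔-p p with ≤-total 0ℚ p
... | inj₁ 0≤p = trans (0≤p⇒∣p∣≡p 0≤p) (sym (p≥q⇒p⊔q≡p (≤-trans (neg-antimono-≤ 0≤p) 0≤p)))
... | inj₂ p≤0 = trans (trans (sym (∣-p∣≡∣p∣ p)) (0≤p⇒∣p∣≡p 0≤-p)) (sym (p≤q⇒p⊔q≡q (≤-trans p≤0 0≤-p)))
  where 0≤-p = neg-antimono-≤ p≤0

p≤∣p∣ : ∀ p → p ≤ ∣ p ∣
p≤∣p∣ p = subst (p ≤_) (sym (∣p∣≡p⊔-p p)) (p≤p⊔q p (- p))

-p≤∣p∣ : ∀ p → - p ≤ ∣ p ∣
-p≤∣p∣ p = subst (- p ≤_) (sym (∣p∣≡p⊔-p p)) (p≤q⊔p p (- p))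

-q≤p≤q⇒∣p∣≤q : ∀ {p q} → - q ≤ p → p ≤ q → ∣ p ∣ ≤ q
-q≤p≤q⇒∣p∣≤q {p} {q} -q≤p p≤q = subst (_≤ q) (sym (∣p∣≡p⊔-p p))
  (⊔-lub p≤q (subst (- p ≤_) (neg-involutive q) (neg-antimono-≤ -q≤p)))

∣p∣≤q⇒-q≤p≤q : ∀ {p q} → ∣ p ∣ ≤ q → - q ≤ p × p ≤ q
∣p∣≤q⇒-q≤p≤q {p} {q} ∣p∣≤q =
  subst (- q ≤_) (neg-involutive p) (neg-antimono-≤ (≤-trans (-p≤∣p∣ p) ∣p∣≤q)) ,
  ≤-trans (p≤∣p∣ p) ∣p∣≤q

∣p∣≤0⇒p≡0 : ∀ {p} → ∣ p ∣ ≤ 0ℚ → p ≡ 0ℚ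
∣p∣≤0⇒p≡0 {p} ∣p∣≤0 = ∣p∣≡0⇒p≡0 p (≤-antisym ∣p∣≤0 (0≤∣p∣ p))

∣p-q∣≡∣q-p∣ : ∀ p q → ∣ p - q ∣ ≡ ∣ q - p ∣
∣p-q∣≡∣q-p∣ p q = trans (cong ∣_∣ (solve 2 (λ p q → p :- q := :- (q :- p)) refl p q)) (∣-p∣≡∣p∣ (q - p))

∣p-q∣≤r : ∀ {p q r} → p - q ≤ r → q - p ≤ r → ∣ p - q ∣ ≤ r
∣p-q∣≤r {p} {q} {r} p-q≤r q-p≤r = -q≤p≤q⇒∣p∣≤q
  (subst (- r ≤_) (solve 2 (λ p q → :- (q :- p) := p :- q) refl p q) (neg-antimono-≤ q-p≤r)) p-q≤r

q≤p≤q+r⇒∣p-q∣≤r : ∀ {p q r} → q ≤ p → p ≤ q + r → ∣ p - q ∣ ≤ r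
q≤p≤q+r⇒∣p-q∣≤r {p} {q} q≤p p≤q+r =
  ∣p-q∣≤r {p} {q} p-q≤r (≤-trans (p≤q⇒p-q≤0 q≤p) (≤-trans (p≤q⇒0≤q-p q≤p) p-q≤r))
  where p-q≤r = p≤q+r⇒p-q≤r p≤q+r

∣p-p⊔q∣≤r : ∀ {p q r} → 0ℚ ≤ r → q ≤ p + r → ∣ p - (p ⊔ q) ∣ ≤ r
∣p-p⊔q∣≤r {p} {q} 0≤r q≤p+r = subst (_≤ _) (∣p-q∣≡∣q-p∣ (p ⊔ q) p)
  (q≤p≤q+r⇒∣p-q∣≤r {p ⊔ q} {p} (p≤p⊔q p q) (⊔-lub (p≤p+q {p} 0≤r) q≤p+r))

∣p-p⊓q∣≤r : ∀ {p q r} → 0ℚ ≤ r → p ≤ q + r → ∣ p - (p ⊓ q) ∣ ≤ r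
∣p-p⊓q∣≤r {p} {q} {r} 0≤r p≤q+r = q≤p≤q+r⇒∣p-q∣≤r (p⊓q≤p p q) p≤p⊓q+r
  where
  p≤p⊓q+r : p ≤ p ⊓ q + r
  p≤p⊓q+r with ⊓-sel p q
  ... | inj₁ p⊓q≡p = subst (λ z → p ≤ z + r) (sym p⊓q≡p) (p≤p+q 0≤r)
  ... | inj₂ p⊓q≡q = subst (λ z → p ≤ z + r) (sym p⊓q≡q) p≤q+r

∣[p+q]-[r+s]∣≤∣p-r∣+∣q-s∣ : ∀ p q r s → ∣ (p + q) - (r + s) ∣ ≤ ∣ p - r ∣ + ∣ q - s ∣
∣[p+q]-[r+s]∣≤∣p-r∣+∣q-s∣ p q r s = subst (_≤ ∣ p - r ∣ + ∣ q - s ∣)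
  (cong ∣_∣ (solve 4 (λ p q r s → (p :- r) :+ (q :- s) := (p :+ q) :- (r :+ s)) refl p q r s))
  (∣p+q∣≤∣p∣+∣q∣ (p - r) (q - s))

∣p⊔q-r⊔s∣≤∣p-r∣+∣q-s∣ : ∀ p q r s → ∣ (p ⊔ q) - (r ⊔ s) ∣ ≤ ∣ p - r ∣ + ∣ q - s ∣
∣p⊔q-r⊔s∣≤∣p-r∣+∣q-s∣ p q r s = ∣p-q∣≤r {p ⊔ q} {r ⊔ s} (bound p q r s)
  (subst₂ (λ x y → (r ⊔ s) - (p ⊔ q) ≤ x + y) (∣p-q∣≡∣q-p∣ r p) (∣p-q∣≡∣q-p∣ s q) (bound r s p q))
  where
  p≤q+∣p-q∣ : ∀ p q → p ≤ q + ∣ p - q ∣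
  p≤q+∣p-q∣ p q = subst (_≤ q + ∣ p - q ∣) (solve 2 (λ p q → q :+ (p :- q) := p) refl p q)
    (+-monoʳ-≤ q (p≤∣p∣ (p - q)))
  bound : ∀ p q r s → (p ⊔ q) - (r ⊔ s) ≤ ∣ p - r ∣ + ∣ q - s ∣
  bound p q r s = p≤q+r⇒p-q≤r (⊔-lub
    (≤-trans (p≤q+∣p-q∣ p r) (+-mono-≤ (p≤p⊔q r s) (p≤p+q (0≤∣p∣ (q - s)))))
    (≤-trans (p≤q+∣p-q∣ q s) (+-mono-≤ (p≤q⊔p r s) (p≤q+p (0≤∣p∣ (p - r))))))

p≤q+rε⇒p≤q : ∀ {p q r} → 0ℚ ≤ r → (∀ ε → 0ℚ < ε → ε ≤ 1ℚ → p ≤ q + r * ε) → p ≤ q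
p≤q+rε⇒p≤q {p} {q} {r} 0≤r p≤q+rε with p ≤? q
... | yes p≤q = p≤q
... | no p≰q with <-dense (≰⇒> p≰q)
... | z , q<z , z<p = contradiction (≤-<-trans (p≤q+rε ε 0<ε ε≤1) q+rε<p) (<-irrefl refl)
  where
  δ = z - q
  0<δ : 0ℚ < δ
  0<δ = subst (_< δ) (+-inverseʳ q) (+-monoˡ-< (- q) q<z)
  r′ = r + 1ℚ
  instance
    r′-positive : Positive r′
    r′-positive =
      positive (≤-<-trans 0≤r (subst (_< r′) (+-identityʳ r) (+-monoʳ-< r (positive⁻¹ 1ℚ))))
  1/r′ = (1/ r′) {{pos⇒nonZero r′}}
  ε = (δ * 1/r′) ⊓ 1ℚ
  0<ε : 0ℚ < ε
  0<ε = ⊓-<-glb (positive⁻¹ (δ * 1/r′) {{pos*pos⇒pos δ {{positive 0<δ}} 1/r′ {{1/pos⇒pos r′}}}})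
                (positive⁻¹ 1ℚ)
  ε≤1 : ε ≤ 1ℚ
  ε≤1 = p⊓q≤q (δ * 1/r′) 1ℚ
  rε≤δ : r * ε ≤ δ
  rε≤δ = begin
    r * ε              ≤⟨ *-monoʳ-≤-nonNeg ε {{nonNegative (<⇒≤ 0<ε)}} (p≤p+q {r} (<⇒≤ (positive⁻¹ 1ℚ))) ⟩
    r′ * ε             ≤⟨ *-monoˡ-≤-nonNeg r′ {{pos⇒nonNeg r′}} (p⊓q≤p (δ * 1/r′) 1ℚ) ⟩
    r′ * (δ * 1/r′)    ≡⟨ solve 3 (λ a d i → a :* (d :* i) := d :* (a :* i)) refl r′ δ 1/r′ ⟩
    δ * (r′ * 1/r′)    ≡⟨ cong (δ *_) (*-inverseʳ r′ {{pos⇒nonZero r′}}) ⟩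
    δ * 1ℚ             ≡⟨ *-identityʳ δ ⟩
    δ                  ∎
    where open ≤-Reasoning
  q+rε<p : q + r * ε < p
  q+rε<p = begin-strict
    q + r * ε  ≤⟨ +-monoʳ-≤ q rε≤δ ⟩
    q + δ      ≡⟨ solve 2 (λ q z → q :+ (z :- q) := z) refl q z ⟩
    z          <⟨ z<p ⟩
    p          ∎
    where open ≤-Reasoning

n/1≡mkℚ : ∀ n → + n / 1 ≡ mkℚ (+ n) 0 (Coprimality.sym (Coprimality.1-coprimeTo n))
n/1≡mkℚ n = normalize-coprime (Coprimality.sym (Coprimality.1-coprimeTo n))

0≤n/1 : ∀ n → 0ℚ ≤ + n / 1
0≤n/1 n = nonNegative⁻¹ (+ n / 1) {{normalize-nonNeg n 1}}

archimedean : ∀ q → ∃ λ n → q ≤ + n / 1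
archimedean q@(mkℚ (+ k) d _) =
  k , subst (q ≤_) (sym (n/1≡mkℚ k)) (*≤* (ℤ.*-monoˡ-≤-nonNeg (+ k) (ℤ.+≤+ (ℕ.s≤s ℕ.z≤n))))
archimedean q@(mkℚ -[1+ _ ] _ _) = 0 , <⇒≤ (negative⁻¹ q)

module Ideals (W : Omega1) where
  open Ops W
  open Ω

  InG-resp : ∀ {f g} → (∀ w → f w ≡ g w) → InG f → InG g
  InG-resp f≡g (T , ⟦T⟧≡f) = T , λ w → trans (⟦T⟧≡f w) (f≡g w)

  InG-proj : ∀ α → InG (proj α)
  InG-proj α = `p α , λ _ → refl

  InG-𝟎 : InG 𝟎
  InG-𝟎 = 0ℚ `· `1 , λ _ → refl

  InG-⊕ : ∀ {f g} → InG f → InG g → InG (f ⊕ g)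
  InG-⊕ (S , ⟦S⟧≡f) (T , ⟦T⟧≡g) = S `+ T , λ w → cong₂ _+_ (⟦S⟧≡f w) (⟦T⟧≡g w)

  InG-· : ∀ {f} c → InG f → InG (c · f)
  InG-· c (T , ⟦T⟧≡f) = c `· T , λ w → cong (c *_) (⟦T⟧≡f w)

  InG-∨ : ∀ {f g} → InG f → InG g → InG (f ∨ g)
  InG-∨ (S , ⟦S⟧≡f) (T , ⟦T⟧≡g) = S `∨ T , λ w → cong₂ _⊔_ (⟦S⟧≡f w) (⟦T⟧≡g w)

  InG-⊝ : ∀ {f} → InG f → InG (⊝ f)
  InG-⊝ f∈G = InG-resp (λ w → -1*p≡-p _) (InG-· (- 1ℚ) f∈G)

  InG-⊖ : ∀ {f g} → InG f → InG g → InG (f ⊖ g)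
  InG-⊖ f∈G g∈G = InG-⊕ f∈G (InG-⊝ g∈G)

  InG-⁺ : ∀ {f} → InG f → InG (f ⁺)
  InG-⁺ f∈G = InG-∨ f∈G InG-𝟎

  InG-∣∣ : ∀ {f} → InG f → InG (λ w → ∣ f w ∣)
  InG-∣∣ f∈G = InG-resp (λ w → sym (∣p∣≡p⊔-p _)) (InG-∨ f∈G (InG-⊝ f∈G))

  InG-⊓ : ∀ {f g} → InG f → InG g → InG (λ w → f w ⊓ g w)
  InG-⊓ {f} {g} f∈G g∈G = InG-resp -[-f⊔-g]≡f⊓g (InG-⊝ (InG-∨ (InG-⊝ f∈G) (InG-⊝ g∈G)))
    where
    -[-f⊔-g]≡f⊓g : ∀ w → - (- f w ⊔ - g w) ≡ f w ⊓ g w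
    -[-f⊔-g]≡f⊓g w = trans (antimono-≤-distrib-⊔ neg-antimono-≤ (- f w) (- g w))
      (cong₂ _⊓_ (neg-involutive (f w)) (neg-involutive (g w)))

  ⟨⟩-intro : ∀ {a x} → InG x → (n : ℕ) → (∀ w → ∣ x w ∣ ≤ ℕ→ℚ n * ∣ a w ∣) → ⟨ a ⟩ x
  ⟨⟩-intro {a} {x} x∈G n x≤na = x∈G , n , λ w →
    ∣p∣≤q⇒-q≤p≤q (subst (λ z → ∣ x w ∣ ≤ ℕ→ℚ n * z) (∣p∣≡p⊔-p (a w)) (x≤na w))

  ⟨⟩-bound : ∀ {a x} → ⟨ a ⟩ x → ∃ λ n → ∀ w → ∣ x w ∣ ≤ ℕ→ℚ n * ∣ a w ∣
  ⟨⟩-bound {a} {x} (_ , n , bounds) = n , λ w →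
    subst (λ z → ∣ x w ∣ ≤ ℕ→ℚ n * z) (sym (∣p∣≡p⊔-p (a w)))
      (-q≤p≤q⇒∣p∣≤q (proj₁ (bounds w)) (proj₂ (bounds w)))

  ∈⟨self⟩ : ∀ {f} → InG f → ⟨ f ⟩ f
  ∈⟨self⟩ {f} f∈G = ⟨⟩-intro {f} {f} f∈G 1 (λ w → ≤-reflexive (sym (*-identityˡ _)))

  ≤-scale⇒⊆⟨⟩ : ∀ {f g} (K : ℚ) → (∀ w → ∣ f w ∣ ≤ K * ∣ g w ∣) → f ⊆⟨⟩ g
  ≤-scale⇒⊆⟨⟩ {f} {g} K f≤Kg x x∈⟨f⟩@(x∈G , _) = ⟨⟩-intro x∈G N x≤Ng
    where
    n = proj₁ (⟨⟩-bound {f} {x} x∈⟨f⟩)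
    N = proj₁ (archimedean (ℕ→ℚ n * K))
    nK≤N = proj₂ (archimedean (ℕ→ℚ n * K))
    x≤Ng : ∀ w → ∣ x w ∣ ≤ ℕ→ℚ N * ∣ g w ∣
    x≤Ng w = begin
      ∣ x w ∣                ≤⟨ proj₂ (⟨⟩-bound {f} {x} x∈⟨f⟩) w ⟩
      ℕ→ℚ n * ∣ f w ∣        ≤⟨ *-monoˡ-≤-nonNeg (ℕ→ℚ n) {{nonNegative (0≤n/1 n)}} (f≤Kg w) ⟩
      ℕ→ℚ n * (K * ∣ g w ∣)  ≡⟨ sym (*-assoc (ℕ→ℚ n) K ∣ g w ∣) ⟩
      ℕ→ℚ n * K * ∣ g w ∣    ≤⟨ *-monoʳ-≤-nonNeg ∣ g w ∣ {{∣-∣-nonNeg (g w)}} nK≤N ⟩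
      ℕ→ℚ N * ∣ g w ∣        ∎
      where open ≤-Reasoning

  ⊆⟨⟩-vanishes : ∀ {z h} → InG z → z ⊆⟨⟩ h → ∀ w → h w ≡ 0ℚ → z w ≡ 0ℚ
  ⊆⟨⟩-vanishes {z} {h} z∈G z⊆h w hw≡0 = ∣p∣≤0⇒p≡0 (begin
    ∣ z w ∣          ≤⟨ proj₂ (⟨⟩-bound {h} {z} (z⊆h z (∈⟨self⟩ z∈G))) w ⟩
    ℕ→ℚ n * ∣ h w ∣  ≡⟨ cong (λ y → ℕ→ℚ n * ∣ y ∣) hw≡0 ⟩
    ℕ→ℚ n * 0ℚ       ≡⟨ *-zeroʳ (ℕ→ℚ n) ⟩
    0ℚ               ∎)
    where
    open ≤-Reasoning
    n = proj₁ (⟨⟩-bound {h} {z} (z⊆h z (∈⟨self⟩ z∈G)))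

  zero⇒⊆⟨𝟎⟩ : ∀ {z} → (∀ w → z w ≡ 0ℚ) → z ⊆⟨⟩ 𝟎
  zero⇒⊆⟨𝟎⟩ {z} z≡0 = ≤-scale⇒⊆⟨⟩ {z} {𝟎} 0ℚ (λ w → ≤-reflexive (cong ∣_∣ (z≡0 w)))

  disjoint⇒MeetZero : ∀ {f g} → (∀ w → f w ≡ 0ℚ ⊎ g w ≡ 0ℚ) → MeetZero f g
  disjoint⇒MeetZero {f} {g} f⊥g z z∈G z⊆f z⊆g = zero⇒⊆⟨𝟎⟩ {z} λ w →
    [ ⊆⟨⟩-vanishes {z} {f} z∈G z⊆f w , ⊆⟨⟩-vanishes {z} {g} z∈G z⊆g w ]′ (f⊥g w)

  MeetZero⇒vanishes : ∀ {t x} → InG t → InG x → MeetZero t x → ∀ w → x w ≢ 0ℚ → t w ≡ 0ℚ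
  MeetZero⇒vanishes {t} {x} t∈G x∈G t∧x≡0 w xw≢0 =
    [ (λ z≡∣t∣ → ∣p∣≡0⇒p≡0 (t w) (trans (sym z≡∣t∣) (z≡0 w)))
    , (λ z≡∣x∣ → contradiction (∣p∣≡0⇒p≡0 (x w) (trans (sym z≡∣x∣) (z≡0 w))) xw≢0)
    ]′ (⊓-sel ∣ t w ∣ ∣ x w ∣)
    where
    z : Fun
    z w = ∣ t w ∣ ⊓ ∣ x w ∣
    z∈G : InG z
    z∈G = InG-⊓ (InG-∣∣ t∈G) (InG-∣∣ x∈G)
    ∣z∣≡z : ∀ w → ∣ z w ∣ ≡ z w
    ∣z∣≡z w = 0≤p⇒∣p∣≡p (⊓-glb (0≤∣p∣ (t w)) (0≤∣p∣ (x w)))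
    z⊆t : z ⊆⟨⟩ t
    z⊆t = ≤-scale⇒⊆⟨⟩ {z} {t} 1ℚ λ w →
      subst₂ _≤_ (sym (∣z∣≡z w)) (sym (*-identityˡ _)) (p⊓q≤p ∣ t w ∣ ∣ x w ∣)
    z⊆x : z ⊆⟨⟩ x
    z⊆x = ≤-scale⇒⊆⟨⟩ {z} {x} 1ℚ λ w →
      subst₂ _≤_ (sym (∣z∣≡z w)) (sym (*-identityˡ _)) (p⊓q≤q ∣ t w ∣ ∣ x w ∣)
    z≡0 : ∀ w → z w ≡ 0ℚ
    z≡0 w = ⊆⟨⟩-vanishes {z} {𝟎} z∈G (t∧x≡0 z z∈G z⊆t z⊆x) w refl

  lipschitz : Term → ℚ
  lipschitz (`p _) = 1ℚ
  lipschitz `1 = 0ℚ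
  lipschitz (s `+ t) = lipschitz s + lipschitz t
  lipschitz (c `· t) = ∣ c ∣ * lipschitz t
  lipschitz (s `∨ t) = lipschitz s + lipschitz t

  0≤lipschitz : ∀ T → 0ℚ ≤ lipschitz T
  0≤lipschitz (`p _) = <⇒≤ (positive⁻¹ 1ℚ)
  0≤lipschitz `1 = ≤-refl
  0≤lipschitz (s `+ t) = +-mono-≤ (0≤lipschitz s) (0≤lipschitz t)
  0≤lipschitz (c `· t) = nonNegative⁻¹ _
    {{nonNeg*nonNeg⇒nonNeg ∣ c ∣ {{∣-∣-nonNeg c}} (lipschitz t) {{nonNegative (0≤lipschitz t)}}}}
  0≤lipschitz (s `∨ t) = +-mono-≤ (0≤lipschitz s) (0≤lipschitz t)

  ⟦⟧-lipschitz : ∀ T {w v δ} → (∀ β → ∣ u w β - u v β ∣ ≤ δ) →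
                 ∣ ⟦ T ⟧ w - ⟦ T ⟧ v ∣ ≤ lipschitz T * δ
  ⟦⟧-lipschitz (`p β) w≈v = subst (_ ≤_) (sym (*-identityˡ _)) (w≈v β)
  ⟦⟧-lipschitz `1 {δ = δ} w≈v = ≤-reflexive (sym (*-zeroˡ δ))
  ⟦⟧-lipschitz (s `+ t) {w} {v} {δ} w≈v =
    ≤-sum {r = lipschitz s} {lipschitz t} {δ}
      (∣[p+q]-[r+s]∣≤∣p-r∣+∣q-s∣ (⟦ s ⟧ w) (⟦ t ⟧ w) (⟦ s ⟧ v) (⟦ t ⟧ v))
      (⟦⟧-lipschitz s w≈v) (⟦⟧-lipschitz t w≈v)
  ⟦⟧-lipschitz (s `∨ t) {w} {v} {δ} w≈v =
    ≤-sum {r = lipschitz s} {lipschitz t} {δ}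
      (∣p⊔q-r⊔s∣≤∣p-r∣+∣q-s∣ (⟦ s ⟧ w) (⟦ t ⟧ w) (⟦ s ⟧ v) (⟦ t ⟧ v))
      (⟦⟧-lipschitz s w≈v) (⟦⟧-lipschitz t w≈v)
  ⟦⟧-lipschitz (c `· t) {w} {v} {δ} w≈v = begin
    ∣ c * ⟦ t ⟧ w - c * ⟦ t ⟧ v ∣    ≡⟨ cong ∣_∣ (solve 3 (λ c x y → c :* x :- c :* y := c :* (x :- y))
                                                     refl c (⟦ t ⟧ w) (⟦ t ⟧ v)) ⟩
    ∣ c * (⟦ t ⟧ w - ⟦ t ⟧ v) ∣      ≡⟨ ∣p*q∣≡∣p∣*∣q∣ c _ ⟩
    ∣ c ∣ * ∣ ⟦ t ⟧ w - ⟦ t ⟧ v ∣    ≤⟨ *-monoˡ-≤-nonNeg ∣ c ∣ {{∣-∣-nonNeg c}} (⟦⟧-lipschitz t w≈v) ⟩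
    ∣ c ∣ * (lipschitz t * δ)        ≡⟨ sym (*-assoc ∣ c ∣ (lipschitz t) δ) ⟩
    ∣ c ∣ * lipschitz t * δ          ∎
    where open ≤-Reasoning

  -- Vanishing at points ever closer to w bounds |t w| by a multiple of |y w|,
  -- because t is Lipschitz for the sup distance.
  approximateZeros⇒⊆⟨⟩ : ∀ {t y} (M : ℚ) → InG t →
    (∀ w ε → 0ℚ < ε → ε ≤ 1ℚ →
      Σ Ω λ v → t v ≡ 0ℚ × (∀ β → ∣ u w β - u v β ∣ ≤ M * ∣ y w ∣ + ε)) →
    t ⊆⟨⟩ y
  approximateZeros⇒⊆⟨⟩ {t} {y} M (T , ⟦T⟧≡t) zeroNear = ≤-scale⇒⊆⟨⟩ {t} {y} (L * M) λ w →
    p≤q+rε⇒p≤q (0≤lipschitz T) λ ε 0<ε ε≤1 →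
      let (v , tv≡0 , w≈v) = zeroNear w ε 0<ε ε≤1 in begin
      ∣ t w ∣                      ≡⟨ cong ∣_∣ (solve 2 (λ x y → x := x :- y :+ y) refl (t w) (t v)) ⟩
      ∣ t w - t v + t v ∣          ≡⟨ cong (λ z → ∣ t w - t v + z ∣) tv≡0 ⟩
      ∣ t w - t v + 0ℚ ∣           ≡⟨ cong ∣_∣ (+-identityʳ _) ⟩
      ∣ t w - t v ∣                ≡⟨ cong₂ (λ a b → ∣ a - b ∣) (sym (⟦T⟧≡t w)) (sym (⟦T⟧≡t v)) ⟩
      ∣ ⟦ T ⟧ w - ⟦ T ⟧ v ∣        ≤⟨ ⟦⟧-lipschitz T w≈v ⟩
      L * (M * ∣ y w ∣ + ε)        ≡⟨ *-distribˡ-+ L (M * ∣ y w ∣) ε ⟩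
      L * (M * ∣ y w ∣) + L * ε    ≡⟨ cong (_+ L * ε) (sym (*-assoc L M ∣ y w ∣)) ⟩
      L * M * ∣ y w ∣ + L * ε      ∎
    where
    open ≤-Reasoning
    L = lipschitz T

module Modifications (W : Omega1) where
  open Omega1 W renaming (_<_ to _≺_)
  open Ops W
  open Ω
  open IsStrictTotalOrder isSTO using (compare)
    renaming (trans to ≺-trans; irrefl to ≺-irrefl; _≟_ to _≟ᵢ_)

  ≢𝟘⇒𝟘≺ : ∀ {β} → β ≢ 𝟘 → 𝟘 ≺ β
  ≢𝟘⇒𝟘≺ {β} β≢𝟘 with compare 𝟘 β
  ... | tri< 𝟘≺β _ _ = 𝟘≺β
  ... | tri≈ _ 𝟘≡β _ = contradiction (sym 𝟘≡β) β≢𝟘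
  ... | tri> _ _ β≺𝟘 = contradiction β≺𝟘 (𝟘-least β)

  0≤two : 0ℚ ≤ two
  0≤two = 0≤n/1 2

  p≤two*p : ∀ {p} → 0ℚ ≤ p → p ≤ two * p
  p≤two*p {p} 0≤p = subst (p ≤_) (solve 1 (λ p → p :+ p := con two :* p) refl p) (p≤p+q 0≤p)

  two*-mono-≤ : ∀ {p q} → p ≤ q → two * p ≤ two * q
  two*-mono-≤ = *-monoˡ-≤-nonNeg two {{nonNegative 0≤two}}

  Doubling : (I → ℚ) → Set
  Doubling f = ∀ γ β → 𝟘 ≺ γ → γ ≺ β → f γ ≤ two * f β

  ⊔-doubling : ∀ {f g} → Doubling f → Doubling g → Doubling (λ β → f β ⊔ g β)
  ⊔-doubling {f} {g} f-doubling g-doubling γ β 𝟘≺γ γ≺β = begin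
    f γ ⊔ g γ                  ≤⟨ ⊔-mono-≤ (f-doubling γ β 𝟘≺γ γ≺β) (g-doubling γ β 𝟘≺γ γ≺β) ⟩
    (two * f β) ⊔ (two * g β)  ≡⟨ sym (*-distribˡ-⊔-nonNeg two {{nonNegative 0≤two}} (f β) (g β)) ⟩
    two * (f β ⊔ g β)          ∎
    where open ≤-Reasoning

  ⊓-doubling : ∀ {f g} → Doubling f → Doubling g → Doubling (λ β → f β ⊓ g β)
  ⊓-doubling {f} {g} f-doubling g-doubling γ β 𝟘≺γ γ≺β = begin
    f γ ⊓ g γ                  ≤⟨ ⊓-mono-≤ (f-doubling γ β 𝟘≺γ γ≺β) (g-doubling γ β 𝟘≺γ γ≺β) ⟩
    (two * f β) ⊓ (two * g β)  ≡⟨ sym (*-distribˡ-⊓-nonNeg two {{nonNegative 0≤two}} (f β) (g β)) ⟩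
    two * (f β ⊓ g β)          ∎
    where open ≤-Reasoning

  around : I → ℚ → ℚ → ℚ → I → ℚ
  around α a b c β with compare β α
  ... | tri< _ _ _ = a
  ... | tri≈ _ _ _ = b
  ... | tri> _ _ _ = c

  around-elim : ∀ {α a b c} (P : ℚ → Set) {β} →
                (β ≺ α → P a) → (β ≡ α → P b) → (α ≺ β → P c) → P (around α a b c β)
  around-elim {α} P {β} below at above with compare β α
  ... | tri< β≺α _ _ = below β≺α
  ... | tri≈ _ β≡α _ = at β≡α
  ... | tri> _ _ α≺β = above α≺β

  around-at : ∀ {α a b c} → around α a b c α ≡ b
  around-at {b = b} = around-elim (_≡ b)
    (λ α≺α → contradiction α≺α (≺-irrefl refl)) (λ _ → refl) (λ α≺α → contradiction α≺α (≺-irrefl refl))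

  around-doubling : ∀ {α a b c} → 0ℚ ≤ a → a ≤ two * b → b ≤ two * c → a ≤ two * c → 0ℚ ≤ c →
                    Doubling (around α a b c)
  around-doubling {α} 0≤a a≤2b b≤2c a≤2c 0≤c γ β _ γ≺β with compare γ α | compare β α
  ... | tri< _ _ _    | tri< _ _ _    = p≤two*p 0≤a
  ... | tri< _ _ _    | tri≈ _ _ _    = a≤2b
  ... | tri< _ _ _    | tri> _ _ _    = a≤2c
  ... | tri≈ _ refl _ | tri< β≺α _ _  = contradiction (≺-trans γ≺β β≺α) (≺-irrefl refl)
  ... | tri≈ _ refl _ | tri≈ _ refl _ = contradiction γ≺β (≺-irrefl refl)
  ... | tri≈ _ _ _    | tri> _ _ _    = b≤2c
  ... | tri> _ _ α≺γ  | tri< β≺α _ _  = contradiction (≺-trans α≺γ (≺-trans γ≺β β≺α)) (≺-irrefl refl)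
  ... | tri> _ _ α≺γ  | tri≈ _ refl _ = contradiction (≺-trans α≺γ γ≺β) (≺-irrefl refl)
  ... | tri> _ _ _    | tri> _ _ _    = p≤two*p 0≤c

  set𝟘 : (I → ℚ) → ℚ → I → ℚ
  set𝟘 f x β with β ≟ᵢ 𝟘
  ... | yes _ = x
  ... | no _ = f β

  set𝟘-elim : ∀ (P : ℚ → Set) {f x} β → (β ≡ 𝟘 → P x) → (β ≢ 𝟘 → P (f β)) → P (set𝟘 f x β)
  set𝟘-elim P β Px Pf with β ≟ᵢ 𝟘
  ... | yes β≡𝟘 = Px β≡𝟘
  ... | no β≢𝟘 = Pf β≢𝟘

  set𝟘-𝟘 : ∀ f x → set𝟘 f x 𝟘 ≡ x
  set𝟘-𝟘 f x = set𝟘-elim (_≡ x) 𝟘 (λ _ → refl) (λ 𝟘≢𝟘 → contradiction refl 𝟘≢𝟘)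

  set𝟘-≢ : ∀ f x {β} → β ≢ 𝟘 → set𝟘 f x β ≡ f β
  set𝟘-≢ f x {β} β≢𝟘 = set𝟘-elim (_≡ f β) β (λ β≡𝟘 → contradiction β≡𝟘 β≢𝟘) (λ _ → refl)

  Ω-⊔ : (w : Ω) (h : I → ℚ) → (∀ β → h β ≤ 1ℚ) → Doubling h → Ω
  Ω-⊔ w h h≤1 h-doubling = record
    { u = λ β → u w β ⊔ h β
    ; u-nn = λ β → ≤-trans (u-nn w β) (p≤p⊔q (u w β) (h β))
    ; u-le1 = λ β → ⊔-lub (u-le1 w β) (h≤1 β)
    ; u-cond = ⊔-doubling {u w} {h} (u-cond w) h-doubling
    }

  Ω-⊓ : (w : Ω) (g : I → ℚ) → (∀ β → 0ℚ ≤ g β) → Doubling g → Ω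
  Ω-⊓ w g 0≤g g-doubling = record
    { u = λ β → u w β ⊓ g β
    ; u-nn = λ β → ⊓-glb (u-nn w β) (0≤g β)
    ; u-le1 = λ β → ≤-trans (p⊓q≤p (u w β) (g β)) (u-le1 w β)
    ; u-cond = ⊓-doubling {u w} {g} (u-cond w) g-doubling
    }

  Ω-set𝟘 : (w : Ω) (x : ℚ) → 0ℚ ≤ x → x ≤ 1ℚ → Ω
  Ω-set𝟘 w x 0≤x x≤1 = record
    { u = set𝟘 (u w) x
    ; u-nn = λ β → set𝟘-elim (0ℚ ≤_) β (λ _ → 0≤x) (λ _ → u-nn w β)
    ; u-le1 = λ β → set𝟘-elim (_≤ 1ℚ) β (λ _ → x≤1) (λ _ → u-le1 w β)
    ; u-cond = λ γ β 𝟘≺γ γ≺β → subst₂ (λ p q → p ≤ two * q)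
        (sym (set𝟘-≢ (u w) x (λ γ≡𝟘 → ≺-irrefl (sym γ≡𝟘) 𝟘≺γ)))
        (sym (set𝟘-≢ (u w) x (λ β≡𝟘 → 𝟘-least γ (subst (γ ≺_) β≡𝟘 γ≺β))))
        (u-cond w γ β 𝟘≺γ γ≺β)
    }

module Pseudocomplements (W : Omega1) (α : Omega1.I W) (α≢𝟘 : α ≢ Omega1.𝟘 W)
                         (c : ℚ) {{c-positive : Positive c}} where
  open Omega1 W renaming (_<_ to _≺_)
  open Ops W
  open Ω
  open Ideals W
  open Modifications W

  a b : Fun
  a = (proj 𝟘 ⊖ (c · proj α)) ⁺
  b = ((c · proj α) ⊖ proj 𝟘) ⁺

  a∈G : InG a
  a∈G = InG-⁺ (InG-⊖ (InG-proj 𝟘) (InG-· c (InG-proj α)))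

  b∈G : InG b
  b∈G = InG-⁺ (InG-⊖ (InG-· c (InG-proj α)) (InG-proj 𝟘))

  a⊥b : ∀ w → a w ≡ 0ℚ ⊎ b w ≡ 0ℚ
  a⊥b w with ≤-total (u w 𝟘) (c * u w α)
  ... | inj₁ w𝟘≤cwα = inj₁ (p≤q⇒p⊔q≡q (p≤q⇒p-q≤0 w𝟘≤cwα))
  ... | inj₂ cwα≤w𝟘 = inj₂ (p≤q⇒p⊔q≡q (p≤q⇒p-q≤0 cwα≤w𝟘))

  ∣a∣≡a : ∀ w → ∣ a w ∣ ≡ a w
  ∣a∣≡a w = 0≤p⇒∣p∣≡p (p≤q⊔p (u w 𝟘 - c * u w α) 0ℚ)

  ∣b∣≡b : ∀ w → ∣ b w ∣ ≡ b w
  ∣b∣≡b w = 0≤p⇒∣p∣≡p (p≤q⊔p (c * u w α - u w 𝟘) 0ℚ)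

  module PositiveBNear (w : Ω) {ε} (0<ε : 0ℚ < ε) (ε≤1 : ε ≤ 1ℚ) where
    x₀ : ℚ
    x₀ = (u w 𝟘 ⊓ (c * u w α) - ε) ⊔ 0ℚ

    x₀≤w𝟘 : x₀ ≤ u w 𝟘
    x₀≤w𝟘 = ⊔-lub (≤-trans (p-q≤p (<⇒≤ 0<ε)) (p⊓q≤p (u w 𝟘) (c * u w α))) (u-nn w 𝟘)

    h : I → ℚ
    h = around α 0ℚ ε ε

    0≤ε : 0ℚ ≤ ε
    0≤ε = <⇒≤ 0<ε

    h≤ε : ∀ β → h β ≤ ε
    h≤ε β = around-elim (_≤ ε) (λ _ → 0≤ε) (λ _ → ≤-refl) (λ _ → ≤-refl)

    v : Ω
    v = Ω-set𝟘 (Ω-⊔ w h (λ β → ≤-trans (h≤ε β) ε≤1) (around-doubling ≤-refl 0≤2ε ε≤2ε 0≤2ε 0≤ε))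
               x₀ (p≤q⊔p (u w 𝟘 ⊓ (c * u w α) - ε) 0ℚ) (≤-trans x₀≤w𝟘 (u-le1 w 𝟘))
      where
      ε≤2ε = p≤two*p 0≤ε
      0≤2ε = ≤-trans 0≤ε ε≤2ε

    v-α : u v α ≡ u w α ⊔ ε
    v-α = trans (set𝟘-≢ _ x₀ α≢𝟘) (cong (u w α ⊔_) around-at)

    0<b[v] : 0ℚ < b v
    0<b[v] = p<q⇒0<[q-p]⁺
      (subst₂ (λ p q → p < c * q) (sym (set𝟘-𝟘 _ x₀)) (sym v-α) x₀<c[wα⊔ε])
      where
      c*-mono = *-monoˡ-≤-nonNeg c {{pos⇒nonNeg c}}
      x₀<c[wα⊔ε] : x₀ < c * (u w α ⊔ ε)
      x₀<c[wα⊔ε] = ⊔-<-lub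
        (p≤q⇒p-r<q 0<ε (≤-trans (p⊓q≤q (u w 𝟘) (c * u w α)) (c*-mono (p≤p⊔q (u w α) ε))))
        (<-≤-trans (positive⁻¹ (c * ε) {{pos*pos⇒pos c ε {{positive 0<ε}}}})
                   (c*-mono (p≤q⊔p (u w α) ε)))

    w≈v : ∀ β → ∣ u w β - u v β ∣ ≤ a w + ε
    w≈v β = set𝟘-elim (λ z → ∣ u w β - z ∣ ≤ a w + ε) β
      (λ { refl → q≤p≤q+r⇒∣p-q∣≤r x₀≤w𝟘 w𝟘≤x₀+a+ε })
      (λ _ → ∣p-p⊔q∣≤r {u w β} (≤-trans 0≤ε ε≤a+ε)
               (≤-trans (h≤ε β) (≤-trans ε≤a+ε (p≤q+p (u-nn w β)))))
      where
      0≤a = p≤q⊔p (u w 𝟘 - c * u w α) 0ℚ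
      ε≤a+ε = p≤q+p {ε} 0≤a
      m = u w 𝟘 ⊓ (c * u w α)
      w𝟘≤x₀+a+ε : u w 𝟘 ≤ x₀ + (a w + ε)
      w𝟘≤x₀+a+ε = begin
        u w 𝟘               ≤⟨ p≤p⊓q+[p-q]⁺ (u w 𝟘) (c * u w α) ⟩
        m + a w             ≡⟨ solve 3 (λ m a e → m :+ a := (m :- e) :+ (a :+ e)) refl m (a w) ε ⟩
        (m - ε) + (a w + ε) ≤⟨ +-monoˡ-≤ (a w + ε) (p≤p⊔q (m - ε) 0ℚ) ⟩
        x₀ + (a w + ε)      ∎
        where open ≤-Reasoning

  ⊥b⇒⊆a : ∀ t → InG t → MeetZero t b → t ⊆⟨⟩ a
  ⊥b⇒⊆a t t∈G t∧b≡0 = approximateZeros⇒⊆⟨⟩ {t} {a} 1ℚ t∈G λ w ε 0<ε ε≤1 →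
    let open PositiveBNear w 0<ε ε≤1 in
    v , MeetZero⇒vanishes {t} {b} t∈G b∈G t∧b≡0 v (≢-sym (<⇒≢ 0<b[v])) ,
    λ β → subst (λ z → ∣ u w β - u v β ∣ ≤ z + ε) (sym (trans (*-identityˡ ∣ a w ∣) (∣a∣≡a w))) (w≈v β)

  c⁻¹ : ℚ
  c⁻¹ = (1/ c) {{pos⇒nonZero c}}

  0≤c⁻¹ : 0ℚ ≤ c⁻¹
  0≤c⁻¹ = <⇒≤ (positive⁻¹ c⁻¹ {{1/pos⇒pos c}})

  c*c⁻¹*p≡p : ∀ p → c * (c⁻¹ * p) ≡ p
  c*c⁻¹*p≡p p = trans (sym (*-assoc c c⁻¹ p))
    (trans (cong (_* p) (*-inverseʳ c {{pos⇒nonZero c}})) (*-identityˡ p))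

  module PositiveANear (w : Ω) {ε} (0<ε : 0ℚ < ε) (ε≤1 : ε ≤ 1ℚ) where
    e : ℚ
    e = ½ * ε

    two*e≡ε : two * e ≡ ε
    two*e≡ε = solve 1 (λ ε → con two :* (con ½ :* ε) := ε) refl ε

    0<e : 0ℚ < e
    0<e = positive⁻¹ e {{pos*pos⇒pos ½ ε {{positive 0<ε}}}}

    0≤e : 0ℚ ≤ e
    0≤e = <⇒≤ 0<e

    e≤ε : e ≤ ε
    e≤ε = subst (e ≤_) two*e≡ε (p≤two*p 0≤e)

    0≤1 : 0ℚ ≤ 1ℚ
    0≤1 = <⇒≤ (positive⁻¹ 1ℚ)

    k m s : ℚ
    k = u w α ⊓ (c⁻¹ * u w 𝟘)
    m = (k - e) ⊔ 0ℚ
    s = (u w α - c⁻¹ * u w 𝟘) ⊔ 0ℚ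

    0≤m : 0ℚ ≤ m
    0≤m = p≤q⊔p (k - e) 0ℚ

    0≤s : 0ℚ ≤ s
    0≤s = p≤q⊔p (u w α - c⁻¹ * u w 𝟘) 0ℚ

    m≤1 : m ≤ 1ℚ
    m≤1 = ⊔-lub (≤-trans (p-q≤p 0≤e) (≤-trans (p⊓q≤p (u w α) (c⁻¹ * u w 𝟘)) (u-le1 w α))) 0≤1

    g : I → ℚ
    g = around α (two * m) m 1ℚ

    v : Ω
    v = Ω-set𝟘 (Ω-⊓ w g 0≤g (around-doubling 0≤2m ≤-refl m≤2 (two*-mono-≤ m≤1) 0≤1))
               (u w 𝟘 ⊔ e) (≤-trans (u-nn w 𝟘) (p≤p⊔q (u w 𝟘) e))
               (⊔-lub (u-le1 w 𝟘) (≤-trans e≤ε ε≤1))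
      where
      0≤2m = ≤-trans 0≤m (p≤two*p 0≤m)
      m≤2 = ≤-trans m≤1 (p≤two*p 0≤1)
      0≤g : ∀ β → 0ℚ ≤ g β
      0≤g β = around-elim (0ℚ ≤_) (λ _ → 0≤2m) (λ _ → 0≤m) (λ _ → 0≤1)

    v-α : u v α ≡ u w α ⊓ m
    v-α = trans (set𝟘-≢ _ (u w 𝟘 ⊔ e) α≢𝟘) (cong (u w α ⊓_) around-at)

    0<a[v] : 0ℚ < a v
    0<a[v] = p<q⇒0<[q-p]⁺
      (subst₂ (λ p q → c * p < q) (sym v-α) (sym (set𝟘-𝟘 _ (u w 𝟘 ⊔ e))) (begin-strict
        c * (u w α ⊓ m)               ≤⟨ *-monoˡ-≤-nonNeg c {{pos⇒nonNeg c}} (p⊓q≤q (u w α) m) ⟩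
        c * m                         ≡⟨ *-distribˡ-⊔-nonNeg c {{pos⇒nonNeg c}} (k - e) 0ℚ ⟩
        (c * (k - e)) ⊔ (c * 0ℚ)      <⟨ ⊔-<-lub c[k-e]<w𝟘⊔e c*0<w𝟘⊔e ⟩
        u w 𝟘 ⊔ e                     ∎))
      where
      open ≤-Reasoning
      c*0<w𝟘⊔e : c * 0ℚ < u w 𝟘 ⊔ e
      c*0<w𝟘⊔e = subst (_< u w 𝟘 ⊔ e) (sym (*-zeroʳ c)) (<-≤-trans 0<e (p≤q⊔p (u w 𝟘) e))
      c[k-e]<w𝟘⊔e : c * (k - e) < u w 𝟘 ⊔ e
      c[k-e]<w𝟘⊔e = begin-strict
        c * (k - e)         <⟨ *-monoʳ-<-pos c (p≤q⇒p-r<q 0<e ≤-refl) ⟩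
        c * k               ≤⟨ *-monoˡ-≤-nonNeg c {{pos⇒nonNeg c}} (p⊓q≤q (u w α) (c⁻¹ * u w 𝟘)) ⟩
        c * (c⁻¹ * u w 𝟘)   ≡⟨ c*c⁻¹*p≡p (u w 𝟘) ⟩
        u w 𝟘               ≤⟨ p≤p⊔q (u w 𝟘) e ⟩
        u w 𝟘 ⊔ e           ∎

    two*s≡two*c⁻¹*∣b∣ : two * s ≡ two * c⁻¹ * ∣ b w ∣
    two*s≡two*c⁻¹*∣b∣ = begin-equality
      two * s              ≡⟨ cong (two *_) s≡c⁻¹*b ⟩
      two * (c⁻¹ * b w)    ≡⟨ sym (*-assoc two c⁻¹ (b w)) ⟩
      two * c⁻¹ * b w      ≡⟨ cong (two * c⁻¹ *_) (sym (∣b∣≡b w)) ⟩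
      two * c⁻¹ * ∣ b w ∣  ∎
      where
      open ≤-Reasoning
      c⁻¹*[c*wα-w𝟘]≡wα-c⁻¹*w𝟘 : c⁻¹ * (c * u w α - u w 𝟘) ≡ u w α - c⁻¹ * u w 𝟘
      c⁻¹*[c*wα-w𝟘]≡wα-c⁻¹*w𝟘 = begin-equality
        c⁻¹ * (c * u w α - u w 𝟘)        ≡⟨ solve 4 (λ i c x y → i :* (c :* x :- y) := (i :* c) :* x :- i :* y)
                                                     refl c⁻¹ c (u w α) (u w 𝟘) ⟩
        (c⁻¹ * c) * u w α - c⁻¹ * u w 𝟘  ≡⟨ cong (λ z → z * u w α - c⁻¹ * u w 𝟘)
                                                    (*-inverseˡ c {{pos⇒nonZero c}}) ⟩
        1ℚ * u w α - c⁻¹ * u w 𝟘         ≡⟨ cong (_- c⁻¹ * u w 𝟘) (*-identityˡ (u w α)) ⟩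
        u w α - c⁻¹ * u w 𝟘              ∎
      s≡c⁻¹*b : s ≡ c⁻¹ * b w
      s≡c⁻¹*b = sym (begin-equality
        c⁻¹ * ((c * u w α - u w 𝟘) ⊔ 0ℚ)          ≡⟨ *-distribˡ-⊔-nonNeg c⁻¹ {{nonNegative 0≤c⁻¹}} _ 0ℚ ⟩
        (c⁻¹ * (c * u w α - u w 𝟘)) ⊔ (c⁻¹ * 0ℚ)  ≡⟨ cong₂ _⊔_ c⁻¹*[c*wα-w𝟘]≡wα-c⁻¹*w𝟘 (*-zeroʳ c⁻¹) ⟩
        s                                        ∎)

    wα≤m+s+e : u w α ≤ m + (s + e)
    wα≤m+s+e = begin
      u w α                ≤⟨ p≤p⊓q+[p-q]⁺ (u w α) (c⁻¹ * u w 𝟘) ⟩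
      k + s                ≡⟨ solve 3 (λ k s e → k :+ s := (k :- e) :+ (s :+ e)) refl k s e ⟩
      (k - e) + (s + e)    ≤⟨ +-monoˡ-≤ (s + e) (p≤p⊔q (k - e) 0ℚ) ⟩
      m + (s + e)          ∎
      where open ≤-Reasoning

    w≈v : ∀ β → ∣ u w β - u v β ∣ ≤ two * s + ε
    w≈v β = set𝟘-elim (λ z → ∣ u w β - z ∣ ≤ D) β
      (λ { refl → ∣p-p⊔q∣≤r {u w 𝟘} 0≤D (≤-trans (≤-trans e≤ε ε≤D) (p≤q+p (u-nn w 𝟘))) })
      (λ β≢𝟘 → ∣p-p⊓q∣≤r 0≤D (around-elim (λ z → u w β ≤ z + D)
        (λ β≺α → begin
          u w β                    ≤⟨ u-cond w β α (≢𝟘⇒𝟘≺ β≢𝟘) β≺α ⟩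
          two * u w α              ≤⟨ two*-mono-≤ wα≤m+s+e ⟩
          two * (m + (s + e))      ≡⟨ solve 3 (λ m s ε → con two :* (m :+ (s :+ con ½ :* ε))
                                                      := con two :* m :+ (con two :* s :+ ε)) refl m s ε ⟩
          two * m + D              ∎)
        (λ { refl → ≤-trans wα≤m+s+e (+-monoʳ-≤ m (+-mono-≤ (p≤two*p 0≤s) e≤ε)) })
        (λ _ → ≤-trans (u-le1 w β) (p≤p+q 0≤D))))
      where
      open ≤-Reasoning
      D = two * s + ε
      0≤2s = ≤-trans 0≤s (p≤two*p 0≤s)
      0≤D : 0ℚ ≤ D
      0≤D = +-mono-≤ 0≤2s (<⇒≤ 0<ε)
      ε≤D : ε ≤ D
      ε≤D = p≤q+p 0≤2s

  ⊥a⇒⊆b : ∀ t → InG t → MeetZero t a → t ⊆⟨⟩ b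
  ⊥a⇒⊆b t t∈G t∧a≡0 = approximateZeros⇒⊆⟨⟩ {t} {b} (two * c⁻¹) t∈G λ w ε 0<ε ε≤1 →
    let open PositiveANear w 0<ε ε≤1 in
    v , MeetZero⇒vanishes {t} {a} t∈G a∈G t∧a≡0 v (≢-sym (<⇒≢ 0<a[v])) ,
    λ β → subst (λ z → ∣ u w β - u v β ∣ ≤ z + ε) two*s≡two*c⁻¹*∣b∣ (w≈v β)

lemma6p7 : (W : Omega1) → let open Omega1 W in let open Ops W in
    (α : I) → α ≢ 𝟘 → (c : ℚ) → Positive c →
    IsPseudocomplement ((proj 𝟘 ⊖ (c · proj α)) ⁺) (((c · proj α) ⊖ proj 𝟘) ⁺)
    × IsPseudocomplement (((c · proj α) ⊖ proj 𝟘) ⁺) ((proj 𝟘 ⊖ (c · proj α)) ⁺)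
lemma6p7 W α α≢𝟘 c c-positive =
  (disjoint⇒MeetZero {a} {b} a⊥b , ⊥b⇒⊆a) ,
  (disjoint⇒MeetZero {b} {a} (swap ∘ a⊥b) , ⊥a⇒⊆b)
  where
  open Ideals W
  open Pseudocomplements W α α≢𝟘 c {{c-positive}}
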